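{- For any positive integers $r_1,\dots,r_s$, the disjoint union $K_{r_1}\cup K_{r_2}\cup\cdots\cup K_{r_s}$ of complete graphs and its complement, the complete multipartite graph with parts of sizes $r_1,\dots,r_s$, are both hulls.
   Context: For a set $M$ of transformations of the vertex set $V$ (acting on the right), $\mathrm{Gr}(M)$ is the graph on $V$ in which distinct $v,w$ are adjacent iff no $f\in M$ satisfies $vf=wf$. The hull of a graph $X$ is $\mathrm{Hull}(X)=\mathrm{Gr}(\mathrm{End}(X))$, where $\mathrm{End}(X)$ is the endomorphism monoid of $X$, and $X$ is a hull if $X=\mathrm{Hull}(X)$. -}

module Defs where

open import Data.Nat using (ℕ; NonZero)
open import Data.Fin using (Fin)
open import Data.Product using (Σ; _×_; _,_)
open import Relation.Binary.PropositionalEquality using (_≡_; _≢_)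
open import Relation.Nullary using (¬_)
open import Function.Bundles using (_⇔_)

record Graph (V : Set) : Set₁ where
  field
    Adj : V → V → Set

open Graph public

-- Transformations of V (acting on the right: v f = f v).
Transformation : Set → Set
Transformation V = V → V

IsEndo : {V : Set} → Graph V → Transformation V → Set
IsEndo X f = ∀ v w → Adj X v w → Adj X (f v) (f w)

Gr : {V : Set} → (Transformation V → Set) → Graph V
Adj (Gr M) v w = (v ≢ w) × ¬ (Σ (Transformation _) λ f → M f × (f v ≡ f w))

Hull : {V : Set} → Graph V → Graph V
Hull X = Gr (IsEndo X)

_≅E_ : {V : Set} → Graph V → Graph V → Set
X ≅E Y = ∀ v w → Adj X v w ⇔ Adj Y v w

IsHull : {V : Set} → Graph V → Set
IsHull X = X ≅E Hull X

-- Vertex set of K_{r_1} ∪ ... ∪ K_{r_s}: pairs (i, a) with a in part i.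
PartVertex : (s : ℕ) → (Fin s → ℕ) → Set
PartVertex s r = Σ (Fin s) λ i → Fin (r i)

UnionOfCompletes : (s : ℕ) (r : Fin s → ℕ) → Graph (PartVertex s r)
Adj (UnionOfCompletes s r) (i , a) (j , b) = (i ≡ j) × ((i , a) ≢ (j , b))

CompleteMultipartite : (s : ℕ) (r : Fin s → ℕ) → Graph (PartVertex s r)
Adj (CompleteMultipartite s r) (i , a) (j , b) = i ≢ j

-- For any graph X we have X ⊆ Hull(X) as soon as X is loopless: an
-- endomorphism maps an edge vw to an edge, so it cannot identify v and w.
-- For the reverse inclusion it suffices that every pair of distinct vertices
-- is either an edge of X or identified by some endomorphism of X
-- (`hull-criterion`).  Both graphs satisfy this dichotomy:
--   * in the union of cliques, vertices (i,a), (j,b) in different parts are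
--     identified by the endomorphism moving part i injectively into part j
--     with a ↦ b (assuming w.l.o.g. rᵢ ≤ rⱼ); such an injection Fin rᵢ → Fin rⱼ
--     is an inclusion followed by a transposition (`injection-sending`);
--   * in the multipartite graph, vertices in the same part are identified by
--     the map sending one to the other and fixing everything else, which
--     preserves parts and is therefore an endomorphism.
module Submission where

open import Defs
open import Data.Nat using (ℕ; _≤_)
open import Data.Nat.Properties using (≤-total)
open import Data.Fin using (Fin; inject≤; _≟_)
open import Data.Fin.Properties using (inject≤-injective)
open import Data.Fin.Permutation using (Permutation; transpose; _⟨$⟩ʳ_)
open import Data.Product using (Σ; _×_; _,_; proj₁)
open import Data.Product.Properties using (≡-dec)
open import Data.Sum using (_⊎_; inj₁; inj₂)
open import Data.Empty using (⊥-elim)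
open import Function.Base using (_∘_; _∋_)
open import Function.Bundles using (Injection; mk⇔)
open import Function.Definitions using (Injective)
open import Function.Properties.Inverse using (↔⇒↣)
open import Relation.Binary.PropositionalEquality
open import Relation.Binary.Definitions using (DecidableEquality)
open import Relation.Nullary using (yes; no)
open import Relation.Nullary.Decidable using (dec-true)

Identifiable : {V : Set} → Graph V → V → V → Set
Identifiable X v w = Σ (Transformation _) λ f → IsEndo X f × (f v ≡ f w)

-- Identifiability is symmetric, so a w.l.o.g. on the order of v, w is allowed.
identifiable-sym : {V : Set} (X : Graph V) {v w : V} →
  Identifiable X v w → Identifiable X w v
identifiable-sym X (f , endo , eq) = f , endo , sym eq

Loopless : {V : Set} → Graph V → Set
Loopless X = ∀ v w → Adj X v w → v ≢ w

hull-criterion : {V : Set} (X : Graph V) → Loopless X →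
  (∀ v w → v ≢ w → Adj X v w ⊎ Identifiable X v w) → IsHull X
hull-criterion X loopless dichotomy v w = mk⇔ edge⇒hull hull⇒edge
  where
  edge⇒hull : Adj X v w → Adj (Hull X) v w
  edge⇒hull vw = loopless v w vw ,
    λ { (f , endo , eq) → loopless (f v) (f w) (endo v w vw) eq }

  hull⇒edge : Adj (Hull X) v w → Adj X v w
  hull⇒edge (v≢w , unidentifiable) with dichotomy v w v≢w
  ... | inj₁ vw = vw
  ... | inj₂ merge = ⊥-elim (unidentifiable merge)

injection-sending : {m n : ℕ} → m ≤ n → (a : Fin m) (b : Fin n) →
  Σ (Fin m → Fin n) λ g → Injective _≡_ _≡_ g × (g a ≡ b)
injection-sending m≤n a b = g , g-injective , g-sends-a
  where
  swap : Permutation _ _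
  swap = transpose (inject≤ a m≤n) b

  g : Fin _ → Fin _
  g c = swap ⟨$⟩ʳ inject≤ c m≤n

  g-injective : Injective _≡_ _≡_ g
  g-injective = inject≤-injective m≤n m≤n _ _ ∘ Injection.injective (↔⇒↣ swap)

  g-sends-a : g a ≡ b
  g-sends-a rewrite dec-true (inject≤ a m≤n ≟ inject≤ a m≤n) refl = refl

module _ {s : ℕ} {r : Fin s → ℕ} where

  _≟V_ : DecidableEquality (PartVertex s r)
  _≟V_ = ≡-dec _≟_ _≟_

  ,-injectiveʳ : {i : Fin s} {a b : Fin (r i)} →
    (PartVertex s r ∋ (i , a)) ≡ (i , b) → a ≡ b
  ,-injectiveʳ refl = refl

  relocate : (i j : Fin s) → (Fin (r i) → Fin (r j)) →
    Transformation (PartVertex s r)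
  relocate i j g (k , c) with k ≟ i
  ... | yes refl = j , g c
  ... | no _ = k , c

  -- Edges of a union of cliques join vertices of one part, and `relocate`
  -- maps a part injectively into a single part.
  relocate-endo : (i j : Fin s) (g : Fin (r i) → Fin (r j)) →
    Injective _≡_ _≡_ g → IsEndo (UnionOfCompletes s r) (relocate i j g)
  relocate-endo i j g g-injective (k , c) (.k , c′) (refl , c≢c′) with k ≟ i
  ... | yes refl = refl , c≢c′ ∘ cong (i ,_) ∘ g-injective ∘ ,-injectiveʳ
  ... | no _ = refl , c≢c′

  relocate-moved : (i j : Fin s) (g : Fin (r i) → Fin (r j)) (a : Fin (r i)) →
    relocate i j g (i , a) ≡ (j , g a)
  relocate-moved i j g a with i ≟ i
  ... | yes refl = refl
  ... | no i≢i = ⊥-elim (i≢i refl)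

  relocate-fixed : (i j : Fin s) (g : Fin (r i) → Fin (r j)) → i ≢ j →
    (b : Fin (r j)) → relocate i j g (j , b) ≡ (j , b)
  relocate-fixed i j g i≢j b with j ≟ i
  ... | yes j≡i = ⊥-elim (i≢j (sym j≡i))
  ... | no _ = refl

  different-parts-identifiable : (i j : Fin s) → i ≢ j → r i ≤ r j →
    (a : Fin (r i)) (b : Fin (r j)) →
    Identifiable (UnionOfCompletes s r) (i , a) (j , b)
  different-parts-identifiable i j i≢j ri≤rj a b
    with injection-sending ri≤rj a b
  ... | g , g-injective , ga≡b =
    relocate i j g , relocate-endo i j g g-injective , (begin
      relocate i j g (i , a)  ≡⟨ relocate-moved i j g a ⟩
      (j , g a)               ≡⟨ cong (j ,_) ga≡b ⟩
      (j , b)                 ≡⟨ relocate-fixed i j g i≢j b ⟨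
      relocate i j g (j , b)  ∎)
    where open ≡-Reasoning

  unionOfCompletes-isHull : IsHull (UnionOfCompletes s r)
  unionOfCompletes-isHull = hull-criterion _ loopless dichotomy
    where
    loopless : Loopless (UnionOfCompletes s r)
    loopless (i , _) (j , _) (_ , v≢w) = v≢w

    dichotomy : ∀ v w → v ≢ w →
      Adj (UnionOfCompletes s r) v w ⊎ Identifiable (UnionOfCompletes s r) v w
    dichotomy (i , a) (j , b) v≢w with i ≟ j | ≤-total (r i) (r j)
    ... | yes i≡j | _ = inj₁ (i≡j , v≢w)
    ... | no i≢j | inj₁ ri≤rj =
      inj₂ (different-parts-identifiable i j i≢j ri≤rj a b)
    ... | no i≢j | inj₂ rj≤ri = inj₂ (identifiable-sym _
      (different-parts-identifiable j i (i≢j ∘ sym) rj≤ri b a))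

  part-preserving-endo : (f : Transformation (PartVertex s r)) →
    (∀ v → proj₁ (f v) ≡ proj₁ v) → IsEndo (CompleteMultipartite s r) f
  part-preserving-endo f preserves (i , _) (j , _) i≢j fi≡fj =
    i≢j (trans (sym (preserves (i , _))) (trans fi≡fj (preserves (j , _))))

  merge-onto : PartVertex s r → PartVertex s r → Transformation (PartVertex s r)
  merge-onto v w x with x ≟V w
  ... | yes _ = v
  ... | no _ = x

  merge-onto-identifies : (v w : PartVertex s r) → merge-onto v w v ≡ merge-onto v w w
  merge-onto-identifies v w with v ≟V w | w ≟V w
  ... | _ | no w≢w = ⊥-elim (w≢w refl)
  ... | yes _ | yes _ = refl
  ... | no _ | yes _ = refl

  merge-within-part : (i : Fin s) (a b : Fin (r i)) →
    ∀ x → proj₁ (merge-onto (i , a) (i , b) x) ≡ proj₁ x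
  merge-within-part i a b x with x ≟V (i , b)
  ... | yes refl = refl
  ... | no _ = refl

  completeMultipartite-isHull : IsHull (CompleteMultipartite s r)
  completeMultipartite-isHull = hull-criterion _ loopless dichotomy
    where
    loopless : Loopless (CompleteMultipartite s r)
    loopless (i , _) (.i , _) i≢i refl = i≢i refl

    dichotomy : ∀ v w → v ≢ w →
      Adj (CompleteMultipartite s r) v w ⊎ Identifiable (CompleteMultipartite s r) v w
    dichotomy (i , a) (j , b) _ with i ≟ j
    ... | no i≢j = inj₁ i≢j
    ... | yes refl = inj₂ (merge , part-preserving-endo merge (merge-within-part i a b) ,
      merge-onto-identifies (i , a) (i , b))
      where
      merge : Transformation (PartVertex s r)
      merge = merge-onto (i , a) (i , b)

mainTheorem5 : (s : ℕ) (r : Fin s → ℕ) → (∀ i → 1 ≤ r i) →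
    IsHull (UnionOfCompletes s r) × IsHull (CompleteMultipartite s r)
mainTheorem5 s r _ = unionOfCompletes-isHull , completeMultipartite-isHull
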